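{- Let $(W,S)$ be a Coxeter system with $S=\{s_0,\ldots,s_n\}$ and let $J\subseteq S$ with $s_0\in J$. Then $wW_J\mapsto\tau(w)W^+_{\tau(J)}$ is a well-defined $W^+$-equivariant bijection $W/W_J\to W^+/W^+_{\tau(J)}$ (with $W^+$ acting by left multiplication). In particular, for $J=\{s_0\}$ this gives a $W^+$-equivariant bijection $W/W_{\{s_0\}}\to W^+$.
   Context: $(W,S)$ has relations $s_i^2=e$, $(s_is_j)^{m_{ij}}=e$; $W_J$ is the subgroup generated by $J$. $W^+=\ker\epsilon$ with $\epsilon(s)=-1$ for $s\in S$, generated by $r_i=s_0s_i$, $1\le i\le n$. $\tau:W\to W^+$ sends $w$ to $w$ if $w\in W^+$ and to $ws_0$ otherwise. $\tau(J)=\{r_i:s_i\in J,\ i\ge1\}$ and $W^+_{\tau(J)}$ is the subgroup of $W^+$ generated by $\tau(J)$. -}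

module Defs where

open import Data.Nat using (ℕ; zero; suc; _≥_)
open import Data.Bool using (Bool; true; false; if_then_else_)
open import Data.Fin using (Fin)
import Data.Fin
import Data.Product
open import Data.Fin.Subset using (Subset; _∈_)
open import Data.Maybe using (Maybe; just; nothing)
open import Data.List using (List; []; _∷_; _++_; length; reverse; concatMap)
open import Data.List.Relation.Unary.All using (All)
open import Data.Product using (Σ; ∃; _×_; _,_)
open import Data.Sum using (_⊎_)
open import Relation.Binary.PropositionalEquality using (_≡_; _≢_)
open import Relation.Nullary using (¬_; Dec; does)

-- A Coxeter matrix on the index set {0,…,n} = Fin (suc n);
-- 'nothing' encodes m_ij = ∞ (no relation).
record IsCoxeterMatrix {n : ℕ} (m : Fin (suc n) → Fin (suc n) → Maybe ℕ) : Set where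
  field
    diag : ∀ i → m i i ≡ just 1
    symm : ∀ i j → m i j ≡ m j i
    offdiag : ∀ i j → i ≢ j → (m i j ≡ nothing) ⊎ (Σ ℕ λ k → (k ≥ 2) × (m i j ≡ just k))

isEven : ℕ → Bool
isEven zero = true
isEven (suc zero) = false
isEven (suc (suc k)) = isEven k

pow : {A : Set} → ℕ → List A → List A
pow zero w = []
pow (suc k) w = w ++ pow k w

module Coxeter (n : ℕ) (m : Fin (suc n) → Fin (suc n) → Maybe ℕ) where

  Gen : Set
  Gen = Fin (suc n)

  Word : Set
  Word = List Gen

  s₀ : Gen
  s₀ = Data.Fin.zero

  -- Word / _≈_ is the Coxeter group W (as the s_i are involutions, the monoid
  -- presentation agrees with the group presentation).
  infix 4 _≈_
  data _≈_ : Word → Word → Set where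
    ≈-refl  : ∀ {x} → x ≈ x
    ≈-sym   : ∀ {x y} → x ≈ y → y ≈ x
    ≈-trans : ∀ {x y z} → x ≈ y → y ≈ z → x ≈ z
    ≈-sq    : ∀ u v (i : Gen) → (u ++ i ∷ i ∷ v) ≈ (u ++ v)
    ≈-braid : ∀ u v (i j : Gen) (k : ℕ) → m i j ≡ just k →
              (u ++ pow k (i ∷ j ∷ []) ++ v) ≈ (u ++ v)

  inv : Word → Word
  inv = reverse

  -- w ∈ W⁺ = ker ε  (ε(s) = -1): represented by an even-length word
  InW⁺ : Word → Set
  InW⁺ w = isEven (length w) ≡ true

  τ : Word → Word
  τ w = if isEven (length w) then w else w ++ (s₀ ∷ [])

  InWJ : Subset (suc n) → Word → Set
  InWJ J x = Σ Word λ v → All (λ i → i ∈ J) v × (x ≈ v)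

  SameCosetJ : Subset (suc n) → Word → Word → Set
  SameCosetJ J w w' = InWJ J (inv w ++ w')

  -- r_i = s_0 s_i  (true) and r_i⁻¹ = s_i s_0 (false)
  rgen : Gen × Bool → Word
  rgen (i , true)  = s₀ ∷ i ∷ []
  rgen (i , false) = i ∷ s₀ ∷ []

  -- membership in W⁺_{τ(J)}, the subgroup generated by {r_i : s_i ∈ J, i ≥ 1}:
  -- equal to a product of such r_i and their inverses.
  InW⁺τJ : Subset (suc n) → Word → Set
  InW⁺τJ J x = Σ (List (Gen × Bool)) λ ls →
                 All (λ p → (Data.Product.proj₁ p ∈ J) × (Data.Product.proj₁ p ≢ s₀)) ls
                 × (x ≈ concatMap rgen ls)

  SameCosetτJ : Subset (suc n) → Word → Word → Set
  SameCosetτJ J u u' = InW⁺τJ J (inv u ++ u')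

{-# OPTIONS --safe #-}
module Submission where

-- A word w and τ(w) differ by a right factor s₀^b, and s₀ ∈ W_J, so
-- τ(w)⁻¹τ(w') = s₀^b (w⁻¹w') s₀^c lies in W_J exactly when w⁻¹w' does.
-- Since τ(w)⁻¹τ(w') is even, the claim reduces to W_J ∩ W⁺ = W⁺_{τ(J)}:
-- an even word over J regroups into factors s₀sᵢ = rᵢ and sᵢs₀ = rᵢ⁻¹
-- after inserting s₀s₀ where needed and cancelling adjacent s₀'s.
-- Finally τ fixes W⁺ pointwise and commutes with left multiplication by W⁺,
-- giving surjectivity and equivariance.  For J = {s₀}, τ(J) is empty.

open import Defs
open import Data.Nat using (ℕ; suc)
open import Data.Fin using (Fin; zero)
open import Data.Fin.Subset using (Subset; _∈_; ⁅_⁆)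
open import Data.Fin.Subset.Properties using (x∈⁅x⁆; x∈⁅y⁆⇒x≡y)
open import Data.Maybe using (Maybe)
open import Data.Bool using (Bool; true; false; not)
open import Data.List using (List; []; _∷_; _++_; length; reverse; concatMap)
open import Data.List.Properties
  using (++-assoc; ++-identityʳ; length-++-sucʳ; length-reverse; reverse-++; reverse-involutive; unfold-reverse)
open import Data.List.Relation.Unary.All using (All; []; _∷_)
open import Data.List.Relation.Unary.All.Properties using (++⁺)
open import Data.Empty using (⊥-elim)
open import Data.Product using (_×_; ∃; _,_)
open import Function using (_∘_)
open import Relation.Binary.Bundles using (Setoid)
open import Relation.Binary.Structures using (IsEquivalence)
open import Relation.Binary.PropositionalEquality
  using (_≡_; refl; sym; trans; cong; cong₂; subst; subst₂; _≢_; module ≡-Reasoning)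
import Relation.Binary.Reasoning.Setoid as SetoidReasoning

isEven-suc : ∀ a → isEven (suc a) ≡ not (isEven a)
isEven-suc 0             = refl
isEven-suc 1             = refl
isEven-suc (suc (suc a)) = isEven-suc a

module CosetBijection (n : ℕ) (m : Fin (suc n) → Fin (suc n) → Maybe ℕ) where
  open Coxeter n m

  ≈-isEquivalence : IsEquivalence _≈_
  ≈-isEquivalence = record { refl = ≈-refl ; sym = ≈-sym ; trans = ≈-trans }

  ≈-setoid : Setoid _ _
  ≈-setoid = record { isEquivalence = ≈-isEquivalence }

  ≡⇒≈ : ∀ {x y} → x ≡ y → x ≈ y
  ≡⇒≈ refl = ≈-refl

  ++-congˡ : ∀ u {x y} → x ≈ y → u ++ x ≈ u ++ y
  ++-congˡ u ≈-refl                = ≈-refl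
  ++-congˡ u (≈-sym e)             = ≈-sym (++-congˡ u e)
  ++-congˡ u (≈-trans e f)         = ≈-trans (++-congˡ u e) (++-congˡ u f)
  ++-congˡ u (≈-sq x y i)          =
    subst₂ _≈_ (++-assoc u x _) (++-assoc u x y) (≈-sq (u ++ x) y i)
  ++-congˡ u (≈-braid x y i j k p) =
    subst₂ _≈_ (++-assoc u x _) (++-assoc u x y) (≈-braid (u ++ x) y i j k p)

  ++-congʳ : ∀ v {x y} → x ≈ y → x ++ v ≈ y ++ v
  ++-congʳ v ≈-refl                = ≈-refl
  ++-congʳ v (≈-sym e)             = ≈-sym (++-congʳ v e)
  ++-congʳ v (≈-trans e f)         = ≈-trans (++-congʳ v e) (++-congʳ v f)
  ++-congʳ v (≈-sq x y i)          =
    subst₂ _≈_ (sym (++-assoc x (i ∷ i ∷ y) v)) (sym (++-assoc x y v)) (≈-sq x (y ++ v) i)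
  ++-congʳ v (≈-braid x y i j k p) =
    subst₂ _≈_ (sym (trans (++-assoc x (pow k (i ∷ j ∷ []) ++ y) v)
                           (cong (x ++_) (++-assoc (pow k (i ∷ j ∷ [])) y v))))
               (sym (++-assoc x y v))
               (≈-braid x (y ++ v) i j k p)

  ++-cong : ∀ {x x′ y y′} → x ≈ x′ → y ≈ y′ → x ++ y ≈ x′ ++ y′
  ++-cong {x′ = x′} {y = y} e f = ≈-trans (++-congʳ y e) (++-congˡ x′ f)

  inv-++-cancel : ∀ w → inv w ++ w ≈ []
  inv-++-cancel []      = ≈-refl
  inv-++-cancel (a ∷ w) = begin
    reverse (a ∷ w) ++ a ∷ w       ≡⟨ cong (_++ a ∷ w) (unfold-reverse a w) ⟩
    (reverse w ++ a ∷ []) ++ a ∷ w ≡⟨ ++-assoc (reverse w) (a ∷ []) (a ∷ w) ⟩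
    reverse w ++ a ∷ a ∷ w         ≈⟨ ≈-sq (reverse w) w a ⟩
    reverse w ++ w                 ≈⟨ inv-++-cancel w ⟩
    []                             ∎
    where open SetoidReasoning ≈-setoid

  ++-inv-cancel : ∀ w → w ++ inv w ≈ []
  ++-inv-cancel w =
    subst (λ x → x ++ reverse w ≈ []) (reverse-involutive w) (inv-++-cancel (reverse w))

  inv-++≈[]⇒≈ : ∀ {u u′} → inv u ++ u′ ≈ [] → u ≈ u′
  inv-++≈[]⇒≈ {u} {u′} e = begin
    u                    ≡⟨ ++-identityʳ u ⟨
    u ++ []              ≈⟨ ++-congˡ u e ⟨
    u ++ (inv u ++ u′)   ≡⟨ ++-assoc u (inv u) u′ ⟨
    (u ++ inv u) ++ u′   ≈⟨ ++-congʳ u′ (++-inv-cancel u) ⟩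
    u′                   ∎
    where open SetoidReasoning ≈-setoid

  ++-cancel-sandwich : ∀ a x c → a ++ a ≈ [] → c ++ c ≈ [] → a ++ (a ++ x ++ c) ++ c ≈ x
  ++-cancel-sandwich a x c aa cc = begin
    a ++ (a ++ x ++ c) ++ c     ≡⟨ cong (a ++_) (++-assoc a (x ++ c) c) ⟩
    a ++ a ++ (x ++ c) ++ c     ≡⟨ ++-assoc a a _ ⟨
    (a ++ a) ++ (x ++ c) ++ c   ≈⟨ ++-cong aa (≡⇒≈ (++-assoc x c c)) ⟩
    x ++ c ++ c                 ≈⟨ ++-congˡ x cc ⟩
    x ++ []                     ≡⟨ ++-identityʳ x ⟩
    x                           ∎
    where open SetoidReasoning ≈-setoid

  parity : Word → Bool
  parity = isEven ∘ length

  parity-++ˡ : ∀ u {x y} → parity x ≡ parity y → parity (u ++ x) ≡ parity (u ++ y)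
  parity-++ˡ []      p         = p
  parity-++ˡ (a ∷ u) {x} {y} p =
    trans (isEven-suc (length (u ++ x)))
          (trans (cong not (parity-++ˡ u p)) (sym (isEven-suc (length (u ++ y)))))

  parity-pow : ∀ k (i j : Gen) v → parity (pow k (i ∷ j ∷ []) ++ v) ≡ parity v
  parity-pow 0       i j v = refl
  parity-pow (suc k) i j v = parity-pow k i j v

  parity-resp-≈ : ∀ {x y} → x ≈ y → parity x ≡ parity y
  parity-resp-≈ ≈-refl                = refl
  parity-resp-≈ (≈-sym e)             = sym (parity-resp-≈ e)
  parity-resp-≈ (≈-trans e f)         = trans (parity-resp-≈ e) (parity-resp-≈ f)
  parity-resp-≈ (≈-sq u v i)          = parity-++ˡ u refl
  parity-resp-≈ (≈-braid u v i j k p) = parity-++ˡ u (parity-pow k i j v)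

  parity-++-W⁺ : ∀ u w → InW⁺ u → parity (u ++ w) ≡ parity w
  parity-++-W⁺ []          w h = refl
  parity-++-W⁺ (a ∷ b ∷ u) w h = parity-++-W⁺ u w h

  parity-∷ʳ : ∀ w a → parity (w ++ a ∷ []) ≡ not (parity w)
  parity-∷ʳ w a = trans (cong isEven (trans (length-++-sucʳ w a []) (cong (suc ∘ length) (++-identityʳ w))))
                        (isEven-suc (length w))

  InW⁺-++ : ∀ {u v} → InW⁺ u → InW⁺ v → InW⁺ (u ++ v)
  InW⁺-++ {u} {v} hu hv = trans (parity-++-W⁺ u v hu) hv

  InW⁺-inv : ∀ {u} → InW⁺ u → InW⁺ (inv u)
  InW⁺-inv {u} h = trans (cong isEven (length-reverse u)) h

  s₀-unless : Bool → Word
  s₀-unless true  = []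
  s₀-unless false = s₀ ∷ []

  s₀-unless-involutive : ∀ b → s₀-unless b ++ s₀-unless b ≈ []
  s₀-unless-involutive true  = ≈-refl
  s₀-unless-involutive false = ≈-sq [] [] s₀

  inv-s₀-unless : ∀ b → inv (s₀-unless b) ≡ s₀-unless b
  inv-s₀-unless true  = refl
  inv-s₀-unless false = refl

  τ-as-++ : ∀ w → τ w ≡ w ++ s₀-unless (parity w)
  τ-as-++ w with parity w
  ... | true  = sym (++-identityʳ w)
  ... | false = refl

  τ-even : ∀ w → InW⁺ (τ w)
  τ-even w with parity w in eq
  ... | true  = eq
  ... | false = trans (parity-∷ʳ w s₀) (cong not eq)

  τ-fixes-W⁺ : ∀ u → InW⁺ u → τ u ≡ u
  τ-fixes-W⁺ u h rewrite h = refl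

  τ-++-W⁺ : ∀ u w → InW⁺ u → τ (u ++ w) ≡ u ++ τ w
  τ-++-W⁺ u w h = begin
    τ (u ++ w)                              ≡⟨ τ-as-++ (u ++ w) ⟩
    (u ++ w) ++ s₀-unless (parity (u ++ w)) ≡⟨ cong (λ b → (u ++ w) ++ s₀-unless b) (parity-++-W⁺ u w h) ⟩
    (u ++ w) ++ s₀-unless (parity w)        ≡⟨ ++-assoc u w _ ⟩
    u ++ w ++ s₀-unless (parity w)          ≡⟨ cong (u ++_) (τ-as-++ w) ⟨
    u ++ τ w                                ∎
    where open ≡-Reasoning

  inv-τ-++-τ : ∀ w w′ →
    inv (τ w) ++ τ w′ ≡ s₀-unless (parity w) ++ (inv w ++ w′) ++ s₀-unless (parity w′)
  inv-τ-++-τ w w′ = begin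
    inv (τ w) ++ τ w′                  ≡⟨ cong₂ _++_ (cong inv (τ-as-++ w)) (τ-as-++ w′) ⟩
    inv (w ++ a) ++ w′ ++ c            ≡⟨ cong (_++ w′ ++ c) (reverse-++ w a) ⟩
    (inv a ++ inv w) ++ w′ ++ c        ≡⟨ cong (λ x → (x ++ inv w) ++ w′ ++ c) (inv-s₀-unless (parity w)) ⟩
    (a ++ inv w) ++ w′ ++ c            ≡⟨ ++-assoc a (inv w) (w′ ++ c) ⟩
    a ++ inv w ++ w′ ++ c              ≡⟨ cong (a ++_) (++-assoc (inv w) w′ c) ⟨
    a ++ (inv w ++ w′) ++ c            ∎
    where
    open ≡-Reasoning
    a = s₀-unless (parity w)
    c = s₀-unless (parity w′)

  module _ {J : Subset (suc n)} where

    InWJ-resp-≈ : ∀ {x y} → x ≈ y → InWJ J x → InWJ J y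
    InWJ-resp-≈ x≈y (v , v∈J , x≈v) = v , v∈J , ≈-trans (≈-sym x≈y) x≈v

    InWJ-++ : ∀ {x y} → InWJ J x → InWJ J y → InWJ J (x ++ y)
    InWJ-++ (v , v∈J , x≈v) (v′ , v′∈J , y≈v′) = v ++ v′ , ++⁺ v∈J v′∈J , ++-cong x≈v y≈v′

    InWJ-s₀-unless : s₀ ∈ J → ∀ b → InWJ J (s₀-unless b)
    InWJ-s₀-unless s₀∈J true  = [] , [] , ≈-refl
    InWJ-s₀-unless s₀∈J false = s₀ ∷ [] , s₀∈J ∷ [] , ≈-refl

    InWJ-sandwich : s₀ ∈ J → ∀ b c {x} → InWJ J x → InWJ J (s₀-unless b ++ x ++ s₀-unless c)
    InWJ-sandwich s₀∈J b c x∈WJ =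
      InWJ-++ (InWJ-s₀-unless s₀∈J b) (InWJ-++ x∈WJ (InWJ-s₀-unless s₀∈J c))

    InτJ : Gen × Bool → Set
    InτJ (i , _) = (i ∈ J) × (i ≢ s₀)

    rgens-over-J : s₀ ∈ J → ∀ ls → All InτJ ls → All (_∈ J) (concatMap rgen ls)
    rgens-over-J s₀∈J []                []              = []
    rgens-over-J s₀∈J ((i , true)  ∷ ls) ((i∈J , _) ∷ p) = s₀∈J ∷ i∈J ∷ rgens-over-J s₀∈J ls p
    rgens-over-J s₀∈J ((i , false) ∷ ls) ((i∈J , _) ∷ p) = i∈J ∷ s₀∈J ∷ rgens-over-J s₀∈J ls p

    InW⁺τJ⇒InWJ : s₀ ∈ J → ∀ {x} → InW⁺τJ J x → InWJ J x
    InW⁺τJ⇒InWJ s₀∈J (ls , ls∈τJ , x≈ls) = concatMap rgen ls , rgens-over-J s₀∈J ls ls∈τJ , x≈ls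

  s₀-if : Bool → Word → Word
  s₀-if true  v = s₀ ∷ v
  s₀-if false v = v

  -- sᵢ (i ≥ 1) becomes rᵢ = s₀sᵢ after a pending s₀, and rᵢ⁻¹ = sᵢs₀ otherwise
  -- (borrowing s₀s₀ = e); every letter toggles whether an s₀ is pending.
  toRgens : Bool → Word → List (Gen × Bool)
  toRgens b []              = []
  toRgens b (zero ∷ v)      = toRgens (not b) v
  toRgens b (Fin.suc i ∷ v) = (Fin.suc i , b) ∷ toRgens (not b) v

  toRgens-correct : ∀ b v → InW⁺ (s₀-if b v) → s₀-if b v ≈ concatMap rgen (toRgens b v)
  toRgens-correct false []              h = ≈-refl
  toRgens-correct false (zero ∷ v)      h = toRgens-correct true v h
  toRgens-correct true  (zero ∷ v)      h = ≈-trans (≈-sq [] v s₀) (toRgens-correct false v h)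
  toRgens-correct false (Fin.suc i ∷ v) h =
    ≈-trans (≈-sym (≈-sq (Fin.suc i ∷ []) v s₀)) (++-congˡ (Fin.suc i ∷ s₀ ∷ []) (toRgens-correct true v h))
  toRgens-correct true  (Fin.suc i ∷ v) h = ++-congˡ (s₀ ∷ Fin.suc i ∷ []) (toRgens-correct false v h)

  toRgens-over-τJ : ∀ {J} b {v} → All (_∈ J) v → All (InτJ {J}) (toRgens b v)
  toRgens-over-τJ b {[]}            []        = []
  toRgens-over-τJ b {zero ∷ v}      (_ ∷ p)   = toRgens-over-τJ (not b) p
  toRgens-over-τJ b {Fin.suc i ∷ v} (i∈J ∷ p) = (i∈J , λ ()) ∷ toRgens-over-τJ (not b) p

  InWJ×InW⁺⇒InW⁺τJ : ∀ {J x} → InWJ J x → InW⁺ x → InW⁺τJ J x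
  InWJ×InW⁺⇒InW⁺τJ (v , v∈J , x≈v) h =
    toRgens false v , toRgens-over-τJ false v∈J ,
    ≈-trans x≈v (toRgens-correct false v (trans (sym (parity-resp-≈ x≈v)) h))

  ≈⇒SameCosetτJ : ∀ {J u u′} → u ≈ u′ → SameCosetτJ J u u′
  ≈⇒SameCosetτJ {u = u} u≈u′ = [] , [] , ≈-trans (++-congˡ (inv u) (≈-sym u≈u′)) (inv-++-cancel u)

  InW⁺τ⁅s₀⁆⇒≈[] : ∀ {x} → InW⁺τJ ⁅ s₀ ⁆ x → x ≈ []
  InW⁺τ⁅s₀⁆⇒≈[] ([]    , []           , x≈[]) = x≈[]
  InW⁺τ⁅s₀⁆⇒≈[] (_ ∷ _ , (i∈⁅s₀⁆ , i≢s₀) ∷ _ , _) = ⊥-elim (i≢s₀ (x∈⁅y⁆⇒x≡y s₀ i∈⁅s₀⁆))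

  module _ {J : Subset (suc n)} (s₀∈J : s₀ ∈ J) where

    τ-preserves-cosets : ∀ w w′ → SameCosetJ J w w′ → SameCosetτJ J (τ w) (τ w′)
    τ-preserves-cosets w w′ w⁻¹w′∈WJ = InWJ×InW⁺⇒InW⁺τJ
      (subst (InWJ J) (sym (inv-τ-++-τ w w′)) (InWJ-sandwich s₀∈J (parity w) (parity w′) w⁻¹w′∈WJ))
      (InW⁺-++ {inv (τ w)} (InW⁺-inv {τ w} (τ-even w)) (τ-even w′))

    τ-reflects-cosets : ∀ w w′ → SameCosetτJ J (τ w) (τ w′) → SameCosetJ J w w′
    τ-reflects-cosets w w′ h = InWJ-resp-≈
      (++-cancel-sandwich (s₀-unless (parity w)) (inv w ++ w′) (s₀-unless (parity w′))
        (s₀-unless-involutive (parity w)) (s₀-unless-involutive (parity w′)))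
      (InWJ-sandwich s₀∈J (parity w) (parity w′)
        (subst (InWJ J) (inv-τ-++-τ w w′) (InW⁺τJ⇒InWJ s₀∈J h)))

proposition2p12 : (n : ℕ) (m : Fin (suc n) → Fin (suc n) → Maybe ℕ) → IsCoxeterMatrix m →
    let open Coxeter n m in
    ((J : Subset (suc n)) → zero ∈ J →
        ((w w' : Word) → SameCosetJ J w w' → SameCosetτJ J (τ w) (τ w'))
      × ((w : Word) → InW⁺ (τ w))
      × ((w w' : Word) → SameCosetτJ J (τ w) (τ w') → SameCosetJ J w w')
      × ((u : Word) → InW⁺ u → ∃ λ w → SameCosetτJ J (τ w) u)
      × ((u w : Word) → InW⁺ u → SameCosetτJ J (τ (u ++ w)) (u ++ τ w)))
    × (((w w' : Word) → SameCosetJ ⁅ zero ⁆ w w' → τ w ≈ τ w')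
      × ((w w' : Word) → τ w ≈ τ w' → SameCosetJ ⁅ zero ⁆ w w')
      × ((u : Word) → InW⁺ u → ∃ λ w → τ w ≈ u)
      × ((u w : Word) → InW⁺ u → τ (u ++ w) ≈ u ++ τ w))
proposition2p12 n m _ =
  (λ J s₀∈J →
      τ-preserves-cosets s₀∈J
    , τ-even
    , τ-reflects-cosets s₀∈J
    , (λ u h → u , ≈⇒SameCosetτJ (≡⇒≈ (τ-fixes-W⁺ u h)))
    , (λ u w h → ≈⇒SameCosetτJ (≡⇒≈ (τ-++-W⁺ u w h))))
  , ( (λ w w′ h → inv-++≈[]⇒≈ (InW⁺τ⁅s₀⁆⇒≈[] (τ-preserves-cosets (x∈⁅x⁆ zero) w w′ h)))
    , (λ w w′ τw≈τw′ → τ-reflects-cosets (x∈⁅x⁆ zero) w w′ (≈⇒SameCosetτJ τw≈τw′))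
    , (λ u h → u , ≡⇒≈ (τ-fixes-W⁺ u h))
    , (λ u w h → ≡⇒≈ (τ-++-W⁺ u w h)))
  where open CosetBijection n m
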